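{- For any string $\sigma\in(T\cup\bar{T})^*$, $OPT(\sigma)\le OPT_d(\sigma)\le 2\,OPT(\sigma)$.
   Context: $T$ is a finite set of open parentheses, each $x\in T$ with a unique congruent close parenthesis $\bar{x}$; a string is well-formed (well-balanced) if it belongs to the Dyck language generated by $S\to SS\mid\varepsilon\mid aS\bar{a}$ ($a\in T$). $OPT(\sigma)$ is the minimum number of edits (insertions, deletions, substitutions) required to make $\sigma$ well-formed, and $OPT_d(\sigma)$ is the minimum number of deletions required to make $\sigma$ well-formed. -}

module Defs where

open import Data.Nat using (ℕ; zero; suc; _≤_)
open import Data.Fin using (Fin)
open import Data.List using (List; []; _∷_; _++_; [_])
open import Data.Product using (_×_)

-- The finite set T of open parentheses is modelled as Fin n (any n);
-- each open parenthesis x has its congruent close parenthesis x̄.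
data Sym (n : ℕ) : Set where
  open′  : Fin n → Sym n
  close′ : Fin n → Sym n

data WF {n : ℕ} : List (Sym n) → Set where
  wf-ε    : WF []
  wf-cat  : ∀ {s t} → WF s → WF t → WF (s ++ t)
  wf-wrap : ∀ a {s} → WF s → WF (open′ a ∷ s ++ [ close′ a ])

data Edit {n : ℕ} : List (Sym n) → List (Sym n) → Set where
  del   : ∀ a xs → Edit (a ∷ xs) xs
  ins   : ∀ a xs → Edit xs (a ∷ xs)
  sub   : ∀ a b xs → Edit (a ∷ xs) (b ∷ xs)
  there : ∀ c {xs ys} → Edit xs ys → Edit (c ∷ xs) (c ∷ ys)

data Delete {n : ℕ} : List (Sym n) → List (Sym n) → Set where
  del   : ∀ a xs → Delete (a ∷ xs) xs
  there : ∀ c {xs ys} → Delete xs ys → Delete (c ∷ xs) (c ∷ ys)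

data Steps {n : ℕ} (R : List (Sym n) → List (Sym n) → Set)
     : ℕ → List (Sym n) → List (Sym n) → Set where
  done : ∀ {s} → Steps R zero s s
  step : ∀ {k s t u} → R s t → Steps R k t u → Steps R (suc k) s u

FixableBy : ∀ {n} → ℕ → List (Sym n) → Set
FixableBy {n} k σ = Data.Product.Σ (List (Sym n)) (λ τ → Steps Edit k σ τ × WF τ)

FixableByDel : ∀ {n} → ℕ → List (Sym n) → Set
FixableByDel {n} k σ = Data.Product.Σ (List (Sym n)) (λ τ → Steps Delete k σ τ × WF τ)

IsMin : (ℕ → Set) → ℕ → Set
IsMin P m = P m × (∀ k → P k → m ≤ k)

IsOPT : ∀ {n} → List (Sym n) → ℕ → Set
IsOPT σ m = IsMin (λ k → FixableBy k σ) m

IsOPTd : ∀ {n} → List (Sym n) → ℕ → Set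
IsOPTd σ m = IsMin (λ k → FixableByDel k σ) m

-- OPT ≤ OPT_d because a deletion is an edit.  For OPT_d ≤ 2·OPT, pull a
-- well-formed result of k edits back to a well-formed subsequence of σ,
-- one edit at a time.  If ρ is a well-formed subsequence of σ′ and σ′ is
-- one edit away from σ, then either the edit disappears among the dropped
-- symbols (ρ is a subsequence of σ with one more deletion), or ρ keeps the
-- symbol the edit wrote; that symbol is then deleted from ρ, and the
-- remainder becomes well-formed again after deleting its matching partner.
-- Each edit therefore costs at most two deletions.  Both minima exist
-- because fixability with exactly k steps is decidable: both relations are
-- finitely branching and well-formedness is decided by a stack automaton.
module Submission where

open import Defs
open import Data.Nat using (ℕ; _≤_; _*_)
open import Data.List using (List)
open import Data.Product using (Σ; _×_)

open import Data.Nat using (zero; suc; _+_; _<_; z≤n; s≤s)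
open import Data.Nat.Properties
  using (≤-refl; ≤-trans; ≤-reflexive; n≤1+n; m≤n⇒m≤1+n; ≮⇒≥; +-suc; m<1+n⇒m<n∨m≡n; +-comm; *-suc)
open import Data.Fin using (Fin) renaming (_≟_ to _≟ᶠ_)
open import Data.List using ([]; _∷_; _++_; [_]; map; allFin; length)
open import Data.List.Properties using (++-assoc; ++-identityʳ)
open import Data.List.Relation.Unary.Any using (Any; any?; satisfied)
import Data.List.Relation.Unary.Any as Any
open import Data.List.Relation.Unary.Any.Properties using (map⁺; ++⁺ˡ; ++⁺ʳ)
open import Data.List.Membership.Propositional.Properties using (∈-allFin)
open import Data.Product using (_,_; proj₁)
open import Data.Sum using (_⊎_; inj₁; inj₂)
open import Relation.Nullary using (Dec; yes; no; ¬_; contradiction)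
open import Relation.Unary using (Decidable)
open import Relation.Binary.PropositionalEquality using (_≡_; refl; sym; cong; subst)

module _ {n : ℕ} where

  private
    Str : Set
    Str = List (Sym n)

  data Subseq : ℕ → Str → Str → Set where
    nil  : Subseq zero [] []
    keep : ∀ {j xs ys} x → Subseq j xs ys → Subseq j (x ∷ xs) (x ∷ ys)
    drop : ∀ {j xs ys} x → Subseq j xs ys → Subseq (suc j) (x ∷ xs) ys

  Subseq≤ : ℕ → Str → Str → Set
  Subseq≤ b xs ys = Σ ℕ (λ j → j ≤ b × Subseq j xs ys)

  subseq-refl : ∀ xs → Subseq zero xs xs
  subseq-refl []       = nil
  subseq-refl (x ∷ xs) = keep x (subseq-refl xs)

  subseq-[] : ∀ xs → Subseq (length xs) xs []
  subseq-[] []       = nil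
  subseq-[] (x ∷ xs) = drop x (subseq-[] xs)

  subseq-++ : ∀ {i j xs ys zs ws} →
              Subseq i xs ys → Subseq j zs ws → Subseq (i + j) (xs ++ zs) (ys ++ ws)
  subseq-++ nil        t = t
  subseq-++ (keep x s) t = keep x (subseq-++ s t)
  subseq-++ (drop x s) t = drop x (subseq-++ s t)

  subseq-dropʳ : ∀ {j} xs {zs} → Subseq j zs [] → Subseq j (xs ++ zs) xs
  subseq-dropʳ []       t = t
  subseq-dropʳ (x ∷ xs) t = keep x (subseq-dropʳ xs t)

  subseq-trans : ∀ {i j xs ys zs} → Subseq i xs ys → Subseq j ys zs → Subseq (i + j) xs zs
  subseq-trans nil        nil         = nil
  subseq-trans (keep x s) (keep .x t) = keep x (subseq-trans s t)
  subseq-trans {i} {suc j} {x ∷ xs} {_} {zs} (keep x s) (drop .x t) =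
    subst (λ k → Subseq k (x ∷ xs) zs) (sym (+-suc i j)) (drop x (subseq-trans s t))
  subseq-trans (drop x s) t           = drop x (subseq-trans s t)

  keep≤ : ∀ {b xs ys} x → Subseq≤ b xs ys → Subseq≤ b (x ∷ xs) (x ∷ ys)
  keep≤ x (j , j≤b , s) = j , j≤b , keep x s

  drop≤ : ∀ {b xs ys} x → Subseq≤ b xs ys → Subseq≤ (suc b) (x ∷ xs) ys
  drop≤ x (j , j≤b , s) = suc j , s≤s j≤b , drop x s

  steps-there : ∀ {R : Str → Str → Set} → (∀ c {xs ys} → R xs ys → R (c ∷ xs) (c ∷ ys)) →
                ∀ {k xs ys} c → Steps R k xs ys → Steps R k (c ∷ xs) (c ∷ ys)
  steps-there th c done        = done
  steps-there th c (step r rs) = step (th c r) (steps-there th c rs)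

  subseq⇒deletions : ∀ {j xs ys} → Subseq j xs ys → Steps Delete j xs ys
  subseq⇒deletions nil        = done
  subseq⇒deletions (keep x s) = steps-there {R = Delete} there x (subseq⇒deletions s)
  subseq⇒deletions (drop x s) = step (del x _) (subseq⇒deletions s)

  deletion⇒edit : ∀ {xs ys : Str} → Delete xs ys → Edit xs ys
  deletion⇒edit (del a xs)  = del a xs
  deletion⇒edit (there c d) = there c (deletion⇒edit d)

  deletions⇒edits : ∀ {k} {xs ys : Str} → Steps Delete k xs ys → Steps Edit k xs ys
  deletions⇒edits done        = done
  deletions⇒edits (step d ds) = step (deletion⇒edit d) (deletions⇒edits ds)

  delete-++ : ∀ s {t π : Str} → Delete (s ++ t) π →
              Σ Str (λ s′ → Delete s s′ × π ≡ s′ ++ t) ⊎ Σ Str (λ t′ → Delete t t′ × π ≡ s ++ t′)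
  delete-++ []      d             = inj₂ (_ , d , refl)
  delete-++ (c ∷ s) (del .c _)    = inj₁ (s , del c s , refl)
  delete-++ (c ∷ s) (there .c d) with delete-++ s d
  ... | inj₁ (s′ , d′ , refl) = inj₁ (c ∷ s′ , there c d′ , refl)
  ... | inj₂ (t′ , d′ , refl) = inj₂ (t′ , d′ , refl)

  wf-delete-repair : ∀ {ρ π : Str} → WF ρ → Delete ρ π → Σ Str (λ ρ′ → Subseq 1 π ρ′ × WF ρ′)
  wf-delete-repair (wf-cat {s} {t} ws wt) d with delete-++ s d
  ... | inj₁ (s′ , d′ , refl) with wf-delete-repair ws d′
  ...   | ρ′ , dropped , wρ′ = ρ′ ++ t , subseq-++ dropped (subseq-refl t) , wf-cat wρ′ wt
  wf-delete-repair (wf-cat {s} {t} ws wt) d | inj₂ (t′ , d′ , refl) with wf-delete-repair wt d′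
  ...   | ρ′ , dropped , wρ′ = s ++ ρ′ , subseq-++ (subseq-refl s) dropped , wf-cat ws wρ′
  wf-delete-repair (wf-wrap a {s} ws) (del _ _) =
    s , subseq-dropʳ s (drop (close′ a) nil) , ws
  wf-delete-repair (wf-wrap a {s} ws) (there _ d) with delete-++ s d
  ... | inj₁ (s′ , d′ , refl) with wf-delete-repair ws d′
  ...   | ρ′ , dropped , wρ′ =
    open′ a ∷ ρ′ ++ [ close′ a ] , keep (open′ a) (subseq-++ dropped (subseq-refl _)) , wf-wrap a wρ′
  wf-delete-repair (wf-wrap a {s} ws) (there _ d) | inj₂ (.[] , del _ _ , refl) =
    s , drop (open′ a) (subseq-dropʳ s nil) , ws

  subseq-pullback : ∀ {j} {σ σ′ ρ : Str} → Edit σ σ′ → Subseq j σ′ ρ →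
                    Subseq≤ (suc j) σ ρ ⊎ Σ Str (λ π → Delete ρ π × Subseq≤ (suc j) σ π)
  subseq-pullback (del a xs)   s           = inj₁ (_ , ≤-refl , drop a s)
  subseq-pullback (ins a xs)   (keep .a s) = inj₂ (_ , del a _ , _ , n≤1+n _ , s)
  subseq-pullback (ins a xs)   (drop .a s) = inj₁ (_ , m≤n⇒m≤1+n (n≤1+n _) , s)
  subseq-pullback (sub a b xs) (keep .b s) = inj₂ (_ , del b _ , _ , ≤-refl , drop a s)
  subseq-pullback (sub a b xs) (drop .b s) = inj₁ (_ , n≤1+n _ , drop a s)
  subseq-pullback (there c e)  (keep .c s) with subseq-pullback e s
  ... | inj₁ s′           = inj₁ (keep≤ c s′)
  ... | inj₂ (π , d , s′) = inj₂ (c ∷ π , there c d , keep≤ c s′)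
  subseq-pullback (there c e)  (drop .c s) with subseq-pullback e s
  ... | inj₁ s′           = inj₁ (drop≤ c s′)
  ... | inj₂ (π , d , s′) = inj₂ (π , d , drop≤ c s′)

  edit-repair : ∀ {b} {σ σ′ ρ : Str} → Edit σ σ′ → Subseq≤ b σ′ ρ → WF ρ →
                Σ Str (λ ρ′ → Subseq≤ (2 + b) σ ρ′ × WF ρ′)
  edit-repair {b} e (j , j≤b , s) wρ with subseq-pullback e s
  ... | inj₁ (i , i≤1+j , s′) = _ , (i , ≤-trans i≤1+j (m≤n⇒m≤1+n (s≤s j≤b)) , s′) , wρ
  ... | inj₂ (π , d , i , i≤1+j , s′) with wf-delete-repair wρ d
  ...   | ρ′ , s″ , wρ′ =
    ρ′ , (i + 1 , i+1≤2+b , subseq-trans s′ s″) , wρ′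
    where
    i+1≤2+b : i + 1 ≤ 2 + b
    i+1≤2+b = ≤-trans (≤-reflexive (+-comm i 1)) (s≤s (≤-trans i≤1+j (s≤s j≤b)))

  edits⇒wf-subseq : ∀ {k} {σ τ : Str} → Steps Edit k σ τ → WF τ →
                    Σ Str (λ ρ → Subseq≤ (2 * k) σ ρ × WF ρ)
  edits⇒wf-subseq {τ = τ} done wτ = τ , (0 , z≤n , subseq-refl τ) , wτ
  edits⇒wf-subseq {suc k} {σ} (step e es) wτ with edits⇒wf-subseq es wτ
  ... | ρ , s , wρ with edit-repair e s wρ
  ...   | ρ′ , s′ , wρ′ = ρ′ , subst (λ b → Subseq≤ b σ ρ′) (sym (*-suc 2 k)) s′ , wρ′

  -- The stack automaton of the Dyck language; the stack holds the pending
  -- open parentheses, innermost first.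
  data Accepts : List (Fin n) → Str → Set where
    empty : Accepts [] []
    push  : ∀ {a st σ} → Accepts (a ∷ st) σ → Accepts st (open′ a ∷ σ)
    pop   : ∀ {a st σ} → Accepts st σ → Accepts (a ∷ st) (close′ a ∷ σ)

  accepts? : ∀ st σ → Dec (Accepts st σ)
  accepts? []       []             = yes empty
  accepts? (a ∷ st) []             = no λ ()
  accepts? st       (open′ a ∷ σ) with accepts? (a ∷ st) σ
  ... | yes acc = yes (push acc)
  ... | no ¬acc = no λ { (push acc) → ¬acc acc }
  accepts? []       (close′ a ∷ σ) = no λ ()
  accepts? (b ∷ st) (close′ a ∷ σ) with a ≟ᶠ b | accepts? st σ
  ... | yes refl | yes acc = yes (pop acc)
  ... | yes refl | no ¬acc = no λ { (pop acc) → ¬acc acc }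
  ... | no a≢b   | _       = no λ { (pop acc) → a≢b refl }

  data Closes : List (Fin n) → Str → Set where
    balanced : ∀ {w} → WF w → Closes [] w
    close    : ∀ {w a st r} → WF w → Closes st r → Closes (a ∷ st) (w ++ close′ a ∷ r)

  closes-prepend : ∀ {u st r} → WF u → Closes st r → Closes st (u ++ r)
  closes-prepend wu (balanced w) = balanced (wf-cat wu w)
  closes-prepend {u} wu (close {w} {a} {st} {r} ww c) =
    subst (Closes (a ∷ st)) (++-assoc u w (close′ a ∷ r)) (close (wf-cat wu ww) c)

  accepts⇒closes : ∀ {st σ} → Accepts st σ → Closes st σ
  accepts⇒closes empty     = balanced wf-ε
  accepts⇒closes (pop acc) = close wf-ε (accepts⇒closes acc)
  accepts⇒closes (push acc) with accepts⇒closes acc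
  ... | close {w} {a} {st} {r} ww c =
    subst (Closes st) (++-assoc (open′ a ∷ w) [ close′ a ] r) (closes-prepend (wf-wrap a ww) c)

  wf-accepts-++ : ∀ {σ} → WF σ → ∀ {st τ} → Accepts st τ → Accepts st (σ ++ τ)
  wf-accepts-++ wf-ε acc = acc
  wf-accepts-++ (wf-cat {s} {t} ws wt) {st} {τ} acc =
    subst (Accepts st) (sym (++-assoc s t τ)) (wf-accepts-++ ws (wf-accepts-++ wt acc))
  wf-accepts-++ (wf-wrap a {s} ws) {st} {τ} acc =
    subst (Accepts st) (cong (open′ a ∷_) (sym (++-assoc s [ close′ a ] τ)))
      (push (wf-accepts-++ ws (pop acc)))

  wf? : (σ : Str) → Dec (WF σ)
  wf? σ with accepts? [] σ
  ... | yes acc with accepts⇒closes acc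
  ...   | balanced wσ = yes wσ
  wf? σ | no ¬acc = no λ wσ → ¬acc (subst (Accepts []) (++-identityʳ σ) (wf-accepts-++ wσ empty))

  record FinitelyBranching (R : Str → Str → Set) : Set where
    field
      successors : (σ : Str) → List (Σ Str (R σ))
      complete   : ∀ {σ τ} → R σ τ → Any (λ p → proj₁ p ≡ τ) (successors σ)

  fixable? : ∀ {R} → FinitelyBranching R → ∀ k σ → Dec (Σ Str (λ τ → Steps R k σ τ × WF τ))
  fixable? R-fb zero σ with wf? σ
  ... | yes wσ = yes (σ , done , wσ)
  ... | no ¬wσ = no λ { (_ , done , wσ) → ¬wσ wσ }
  fixable? R-fb (suc k) σ with any? (λ p → fixable? R-fb k (proj₁ p)) (successors σ)
    where open FinitelyBranching R-fb
  ... | yes some with satisfied some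
  ...   | (_ , r) , (τ , rs , wτ) = yes (τ , step r rs , wτ)
  fixable? R-fb (suc k) σ | no none =
    no λ { (τ , step r rs , wτ) → none (Any.map (λ { refl → τ , rs , wτ }) (complete r)) }
    where open FinitelyBranching R-fb

  symbols : Str
  symbols = map open′ (allFin n) ++ map close′ (allFin n)

  ∈-symbols : ∀ a → Any (a ≡_) symbols
  ∈-symbols (open′ i)  = ++⁺ˡ (map⁺ (Any.map (cong open′) (∈-allFin i)))
  ∈-symbols (close′ i) = ++⁺ʳ (map open′ (allFin n)) (map⁺ (Any.map (cong close′) (∈-allFin i)))

  delete-successors : (σ : Str) → List (Σ Str (Delete σ))
  delete-successors []       = []
  delete-successors (c ∷ xs) = (xs , del c xs) ∷ map under (delete-successors xs)
    where
    under : Σ Str (Delete xs) → Σ Str (Delete (c ∷ xs))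
    under (ys , d) = c ∷ ys , there c d

  delete-complete : ∀ {σ τ} → Delete σ τ → Any (λ p → proj₁ p ≡ τ) (delete-successors σ)
  delete-complete (del a xs)  = Any.here refl
  delete-complete (there c d) = Any.there (map⁺ (Any.map (cong (c ∷_)) (delete-complete d)))

  delete-branching : FinitelyBranching Delete
  delete-branching = record { successors = delete-successors ; complete = delete-complete }

  insertions : (σ : Str) → List (Σ Str (Edit σ))
  insertions σ = map (λ a → a ∷ σ , ins a σ) symbols

  insertion-complete : ∀ a σ → Any (λ p → proj₁ p ≡ a ∷ σ) (insertions σ)
  insertion-complete a σ = map⁺ (Any.map (λ { refl → refl }) (∈-symbols a))

  edit-successors : (σ : Str) → List (Σ Str (Edit σ))
  edit-successors []       = insertions []
  edit-successors (c ∷ xs) =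
    insertions (c ∷ xs) ++ (xs , del c xs) ∷ map substitute symbols ++ map under (edit-successors xs)
    where
    substitute : Sym n → Σ Str (Edit (c ∷ xs))
    substitute b = b ∷ xs , sub c b xs
    under : Σ Str (Edit xs) → Σ Str (Edit (c ∷ xs))
    under (ys , e) = c ∷ ys , there c e

  edit-complete : ∀ {σ τ} → Edit σ τ → Any (λ p → proj₁ p ≡ τ) (edit-successors σ)
  edit-complete (ins a [])       = insertion-complete a []
  edit-complete (ins a (c ∷ xs)) = ++⁺ˡ (insertion-complete a (c ∷ xs))
  edit-complete (del a xs)       = ++⁺ʳ (insertions (a ∷ xs)) (Any.here refl)
  edit-complete (sub a b xs)     =
    ++⁺ʳ (insertions (a ∷ xs)) (Any.there (++⁺ˡ (map⁺ (Any.map (λ { refl → refl }) (∈-symbols b)))))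
  edit-complete (there c {xs} e) =
    ++⁺ʳ (insertions (c ∷ xs)) (Any.there (++⁺ʳ _ (map⁺ (Any.map (cong (c ∷_)) (edit-complete e)))))

  edit-branching : FinitelyBranching Edit
  edit-branching = record { successors = edit-successors ; complete = edit-complete }

module _ {P : ℕ → Set} (P? : Decidable P) where

  least-below : ∀ m → Σ ℕ (IsMin P) ⊎ (∀ k → k < m → ¬ P k)
  least-below zero = inj₂ λ _ ()
  least-below (suc m) with least-below m
  ... | inj₁ found = inj₁ found
  ... | inj₂ none with P? m
  ...   | yes pm = inj₁ (m , pm , λ k pk → ≮⇒≥ λ k<m → none k k<m pk)
  ...   | no ¬pm = inj₂ λ k k<1+m → not-below (m<1+n⇒m<n∨m≡n k<1+m)
    where
    not-below : ∀ {k} → k < m ⊎ k ≡ m → ¬ P k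
    not-below (inj₁ k<m)  = none _ k<m
    not-below (inj₂ refl) = ¬pm

  least : ∀ {m} → P m → Σ ℕ (IsMin P)
  least {m} pm with least-below (suc m)
  ... | inj₁ min  = min
  ... | inj₂ none = contradiction pm (none m ≤-refl)

lemma1 : (n : ℕ) (σ : List (Sym n)) →
    Σ ℕ (λ opt → Σ ℕ (λ optd →
      IsOPT σ opt × IsOPTd σ optd × opt ≤ optd × optd ≤ 2 * opt))
lemma1 n σ
  with optd , fixd@(τd , dels , wτd) , optd-min
         ← least (λ k → fixable? delete-branching k σ) ([] , subseq⇒deletions (subseq-[] σ) , wf-ε)
  with opt , fix@(τ , edits , wτ) , opt-min
         ← least (λ k → fixable? edit-branching k σ) (τd , deletions⇒edits dels , wτd)
  with ρ , (j , j≤2opt , s) , wρ ← edits⇒wf-subseq edits wτ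
  = opt , optd , (fix , opt-min) , (fixd , optd-min)
  , opt-min optd (τd , deletions⇒edits dels , wτd)
  , ≤-trans (optd-min j (ρ , subseq⇒deletions s , wρ)) j≤2opt
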